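{- Let $n$ and $m$ be positive integers with $m > f(n)$, and write $T_m = 1 + 2 + \cdots + m$. Then \[ m + p(T_m - n;\ m-1) \geq f(n) + \sqrt{2(g(n)+f(n)+1)} + 1/2 \] and \[ m + q(T_m - n;\ m-2) \geq f(n) + \sqrt{2(g(n)+f(n)+1)} + 3/2. \]
   Context: For $A \subseteq \{0,1,2,\ldots\}$, $\partial A = \{z \in A : \{z-1,z+1\} \not\subseteq A\}$, $vol(A)=\sum_{z\in A} z$, $per(A) = \sum_{z \in \partial A} z$ (both $0$ for the empty set), and $A^c = \{0,1,2,\ldots\}\setminus A$. For integers $x\ge 0$, $k \ge 0$: $p(x;k) = \min\{per(A) : A \subseteq \{0,\ldots,k\},\ vol(A)=x\}$ and $q(x;k) = \min\{per(A^c) : A \subseteq \{0,\ldots,k\},\ vol(A)=x\}$, where the minimum over an empty family is $\infty$. Also $f(n) = \lceil (-1+\sqrt{1+8n})/2 \rceil$ and $g(n) = f(n)(f(n)+1)/2 - n$. -}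

module Defs where

open import Data.Nat using (ℕ; zero; suc; _+_; _*_; _∸_; _≤_; _<?_; _≤ᵇ_)
open import Data.Bool using (Bool; true; false; _∧_; _∨_; not; if_then_else_)
open import Data.Fin using (fromℕ<)
open import Data.Fin.Subset using (Subset)
open import Data.Vec using (lookup)
open import Data.Product using (_×_)
open import Relation.Nullary using (yes; no)

T : ℕ → ℕ
T zero    = 0
T (suc m) = suc m + T m

-- f(n) = ⌈(-1 + √(1+8n))/2⌉ = least t ∈ ℕ with (-1+√(1+8n))/2 ≤ t,
-- i.e. least t with 1 + 8n ≤ (2t+1)^2.  Found by upward search from 0
-- (the answer is ≤ n, so fuel n+1 suffices).
fSearch : ℕ → ℕ → ℕ → ℕ
fSearch n zero       t = t
fSearch n (suc fuel) t =
  if (1 + 8 * n) ≤ᵇ ((2 * t + 1) * (2 * t + 1)) then t else fSearch n fuel (suc t)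

f : ℕ → ℕ
f n = fSearch n (suc n) 0

-- g(n) = f(n)(f(n)+1)/2 - n  (nonnegative by definition of f)
g : ℕ → ℕ
g n = T (f n) ∸ n

-- Membership in A ⊆ {0,…,N-1}, encoded as a Subset N, viewed as a predicate on ℕ
inA : {N : ℕ} → Subset N → ℕ → Bool
inA {N} A z with z <? N
... | yes p = lookup A (fromℕ< p)
... | no _  = false

-- "z - 1 ∈ P" for a set P ⊆ ℕ (false when z = 0, since -1 ∉ ℕ)
predIn : (ℕ → Bool) → ℕ → Bool
predIn P zero    = false
predIn P (suc z) = P z

isBd : (ℕ → Bool) → ℕ → Bool
isBd P z = P z ∧ not (predIn P z ∧ P (suc z))

sumBelow : (ℕ → ℕ) → ℕ → ℕ
sumBelow h zero    = 0
sumBelow h (suc N) = h N + sumBelow h N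

vol : {N : ℕ} → Subset N → ℕ
vol {N} A = sumBelow (λ z → if inA A z then z else 0) N

-- per(A) for A ⊆ {0,…,N-1}: ∂A ⊆ {0,…,N-1}
per : {N : ℕ} → Subset N → ℕ
per {N} A = sumBelow (λ z → if isBd (inA A) z then z else 0) N

-- per(A^c) for A ⊆ {0,…,N-1}, A^c = ℕ ∖ A: every z ≥ N+1 is interior to A^c
-- (z-1, z, z+1 ≥ N all lie in A^c), so ∂(A^c) ⊆ {0,…,N}.
perCompl : {N : ℕ} → Subset N → ℕ
perCompl {N} A = sumBelow (λ z → if isBd (λ y → not (inA A y)) z then z else 0) (suc N)

-- x ≥ c + √S + h/2   (x, c, S, h ∈ ℕ), stated without reals:
-- 2x - 2c - h ≥ 2√S  ⟺  2c + h ≤ 2x  and  4S ≤ (2x - 2c - h)^2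
GeSqrt : ℕ → ℕ → ℕ → ℕ → Set
GeSqrt x c S h =
  (2 * c + h ≤ 2 * x) × (4 * S ≤ (2 * x ∸ (2 * c + h)) * (2 * x ∸ (2 * c + h)))

module Submission where

-- Let A ⊆ {0,…,N-1} with vol(A) = T m - n, where
-- m > t := f(n).  Since n ≤ T t < T m the volume is positive, so A has a
-- largest element e, and vol(A) ≤ 0 + 1 + … + e = T e, i.e. T m ≤ T e + n.
-- The top element e lies in ∂A (e+1 ∉ A), so per(A) ≥ e; dually e+1 lies
-- in ∂(A^c), so per(A^c) ≥ e+1.  It then remains to show the purely
-- arithmetic fact: writing m = t+1+u and k = 2u+2e+1,
--   8·(T t - n + t + 1) ≤ k²,
-- which follows from T m ≤ T e + n, n ≤ T t and 2·T x = x(x+1); since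
-- 2(m+e) = 2t + 1 + k, this is exactly the claimed real inequality
-- m + e + j ≥ t + √(2(T t - n + t + 1)) + (2j+1)/2 for j = 0, 1.

open import Defs
open import Data.Nat using (ℕ; zero; suc; _+_; _*_; _∸_; _≤_; _<_; _<?_; _≤ᵇ_; z≤n; s≤s)
open import Data.Nat.Properties
open import Data.Bool using (Bool; true; false; not; if_then_else_) renaming (T to True)
open import Data.Empty using (⊥-elim)
open import Data.Fin.Subset using (Subset)
open import Data.Product using (_×_; _,_)
open import Data.Sum using (inj₁; inj₂)
open import Relation.Nullary using (yes; no)
open import Relation.Binary.PropositionalEquality
open import Data.Nat.Tactic.RingSolver using (solve-∀)

double-T : ∀ x → 2 * T x ≡ x * suc x
double-T zero    = refl
double-T (suc x) = begin
  2 * (suc x + T x)          ≡⟨ *-distribˡ-+ 2 (suc x) (T x) ⟩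
  2 * suc x + 2 * T x        ≡⟨ cong (2 * suc x +_) (double-T x) ⟩
  2 * suc x + x * suc x      ≡⟨ step x ⟩
  suc x * suc (suc x)        ∎
  where
  open ≡-Reasoning
  step : ∀ x → 2 * suc x + x * suc x ≡ suc x * suc (suc x)
  step = solve-∀

T-mono : ∀ {a b} → a ≤ b → T a ≤ T b
T-mono {zero}          _         = z≤n
T-mono {suc a} {suc b} (s≤s a≤b) = +-mono-≤ (s≤s a≤b) (T-mono a≤b)

T-strict : ∀ {a b} → a < b → T a < T b
T-strict {a} a<b = ≤-trans (s≤s (m≤n+m (T a) a)) (T-mono a<b)

odd-square : ∀ t → (2 * t + 1) * (2 * t + 1) ≡ 1 + 8 * T t
odd-square t = begin
  (2 * t + 1) * (2 * t + 1)  ≡⟨ expand t ⟩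
  1 + 4 * (t * suc t)        ≡⟨ cong (λ z → 1 + 4 * z) (sym (double-T t)) ⟩
  1 + 4 * (2 * T t)          ≡⟨ cong (1 +_) (sym (*-assoc 4 2 (T t))) ⟩
  1 + 8 * T t                ∎
  where
  open ≡-Reasoning
  expand : ∀ t → (2 * t + 1) * (2 * t + 1) ≡ 1 + 4 * (t * suc t)
  expand = solve-∀

fSearch-sound : ∀ n fuel t → n ≤ T (t + fuel) → n ≤ T (fSearch n fuel t)
fSearch-sound n zero t n≤T = subst (λ z → n ≤ T z) (+-identityʳ t) n≤T
fSearch-sound n (suc fuel) t n≤T
  with (1 + 8 * n) ≤ᵇ ((2 * t + 1) * (2 * t + 1)) in test
... | true  = *-cancelˡ-≤ 8 (≤-pred (subst (1 + 8 * n ≤_) (odd-square t) passed))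
  where
  passed : 1 + 8 * n ≤ (2 * t + 1) * (2 * t + 1)
  passed = ≤ᵇ⇒≤ (1 + 8 * n) _ (subst True (sym test) _)
... | false = fSearch-sound n fuel (suc t) (subst (λ z → n ≤ T z) (+-suc t fuel) n≤T)

n≤T[fn] : ∀ n → n ≤ T (f n)
n≤T[fn] n = fSearch-sound n (suc n) 0 (≤-trans (n≤1+n n) (m≤m+n (suc n) (T n)))

sumBelow-mono : ∀ (h h' : ℕ → ℕ) N → (∀ z → h z ≤ h' z) → sumBelow h N ≤ sumBelow h' N
sumBelow-mono h h' zero    _  = z≤n
sumBelow-mono h h' (suc N) le = +-mono-≤ (le N) (sumBelow-mono h h' N le)

term≤sumBelow : ∀ (h : ℕ → ℕ) {N} z → z < N → h z ≤ sumBelow h N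
term≤sumBelow h {suc N} z (s≤s z≤N) with m≤n⇒m<n∨m≡n z≤N
... | inj₁ z<N = ≤-trans (term≤sumBelow h z z<N) (m≤n+m _ (h N))
... | inj₂ refl = m≤m+n (h z) _

sumBelow-id : ∀ k → sumBelow (λ z → z) (suc k) ≡ T k
sumBelow-id zero    = refl
sumBelow-id (suc k) = cong (suc k +_) (sumBelow-id k)

volWeight : (ℕ → Bool) → ℕ → ℕ
volWeight P z = if P z then z else 0

vol≤T : ∀ (P : ℕ → Bool) k → sumBelow (volWeight P) (suc k) ≤ T k
vol≤T P k = subst (sumBelow (volWeight P) (suc k) ≤_) (sumBelow-id k)
                  (sumBelow-mono (volWeight P) (λ z → z) (suc k) weight≤)
  where
  weight≤ : ∀ z → volWeight P z ≤ z
  weight≤ z with P z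
  ... | true  = ≤-refl
  ... | false = z≤n

record Top (P : ℕ → Bool) (N : ℕ) : Set where
  field
    e        : ℕ
    e<N      : e < N
    e∈P      : P e ≡ true
    suc-e∉P  : P (suc e) ≡ false
    vol≤T[e] : sumBelow (volWeight P) N ≤ T e

top : ∀ (P : ℕ → Bool) N → P N ≡ false → 0 < sumBelow (volWeight P) N → Top P N
top P (suc N) N+1∉P pos with P N in N∈?P
... | true  = record { e = N ; e<N = ≤-refl ; e∈P = N∈?P ; suc-e∉P = N+1∉P
                     ; vol≤T[e] = vol≤T P N }
... | false = record { e = e ; e<N = m<n⇒m<1+n e<N ; e∈P = e∈P
                     ; suc-e∉P = suc-e∉P ; vol≤T[e] = subst (_≤ T e) (sym skip) vol≤T[e] }
  where
  skip : sumBelow (volWeight P) (suc N) ≡ sumBelow (volWeight P) N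
  skip = cong (λ b → (if b then N else 0) + sumBelow (volWeight P) N) N∈?P
  open Top (top P N N∈?P pos)

N∉A : ∀ {N} (A : Subset N) → inA A N ≡ false
N∉A {N} A with N <? N
... | yes N<N = ⊥-elim (<-irrefl refl N<N)
... | no  _   = refl

bdWeight : (ℕ → Bool) → ℕ → ℕ
bdWeight P z = if isBd P z then z else 0

bd≤per : ∀ (P : ℕ → Bool) {N} z → z < N → isBd P z ≡ true → z ≤ sumBelow (bdWeight P) N
bd≤per P z z<N z∈∂P =
  subst (λ b → (if b then z else 0) ≤ _) z∈∂P (term≤sumBelow (bdWeight P) z z<N)

edge∈∂ : ∀ (P : ℕ → Bool) e → P e ≡ true → P (suc e) ≡ false → isBd P e ≡ true
edge∈∂ P e e∈P e+1∉P rewrite e∈P | e+1∉P with predIn P e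
... | true  = refl
... | false = refl

edge∈∂ᶜ : ∀ (P : ℕ → Bool) e → P e ≡ true → P (suc e) ≡ false → isBd (λ y → not (P y)) (suc e) ≡ true
edge∈∂ᶜ P e e∈P e+1∉P rewrite e∈P | e+1∉P = refl

GeSqrt-intro : ∀ {x c S h} k → 2 * c + h + k ≤ 2 * x → 4 * S ≤ k * k → GeSqrt x c S h
GeSqrt-intro {x} {c} {S} {h} k le sq = c+h≤x , ≤-trans sq (*-mono-≤ k≤gap k≤gap)
  where
  c+h≤x : 2 * c + h ≤ 2 * x
  c+h≤x = ≤-trans (m≤m+n (2 * c + h) k) le
  k≤gap : k ≤ 2 * x ∸ (2 * c + h)
  k≤gap = subst (_≤ 2 * x ∸ (2 * c + h)) (m+n∸m≡n (2 * c + h) k) (∸-monoˡ-≤ (2 * c + h) le)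

key-inequality : ∀ {n} t u e → n ≤ T t → T (suc (t + u)) ≤ T e + n →
  4 * (2 * ((T t ∸ n) + t + 1)) ≤ (2 * u + 2 * e + 1) * (2 * u + 2 * e + 1)
key-inequality {n} t u e n≤Tt Tm≤Te+n =
  +-cancelʳ-≤ (4 * (2 * T m)) _ _ (begin
    4 * (2 * (G + t + 1)) + 4 * (2 * T m)
      ≤⟨ +-monoʳ-≤ (4 * (2 * (G + t + 1))) (*-monoʳ-≤ 4 (*-monoʳ-≤ 2 Tm≤Te+n)) ⟩
    4 * (2 * (G + t + 1)) + 4 * (2 * (T e + n))
      ≡⟨ regroup G n t (T e) ⟩
    4 * (2 * (G + n)) + 4 * (2 * T e) + 8 * (t + 1)
      ≡⟨ cong (λ z → 4 * (2 * z) + 4 * (2 * T e) + 8 * (t + 1)) (m∸n+n≡m n≤Tt) ⟩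
    4 * (2 * T t) + 4 * (2 * T e) + 8 * (t + 1)
      ≡⟨ cong₂ (λ a b → 4 * a + 4 * b + 8 * (t + 1)) (double-T t) (double-T e) ⟩
    4 * (t * suc t) + 4 * (e * suc e) + 8 * (t + 1)
      ≤⟨ m≤m+n _ _ ⟩
    4 * (t * suc t) + 4 * (e * suc e) + 8 * (t + 1) + (4 * u * (2 * t + 2 * u + 2 * e + 4) + 1)
      ≡⟨ expand t u e ⟩
    k * k + 4 * (m * suc m)
      ≡⟨ cong (λ z → k * k + 4 * z) (sym (double-T m)) ⟩
    k * k + 4 * (2 * T m) ∎)
  where
  open ≤-Reasoning
  m = suc (t + u)
  k = 2 * u + 2 * e + 1
  G = T t ∸ n
  regroup : ∀ G n t Te → 4 * (2 * (G + t + 1)) + 4 * (2 * (Te + n))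
                       ≡ 4 * (2 * (G + n)) + 4 * (2 * Te) + 8 * (t + 1)
  regroup = solve-∀
  expand : ∀ t u e →
    4 * (t * suc t) + 4 * (e * suc e) + 8 * (t + 1) + (4 * u * (2 * t + 2 * u + 2 * e + 4) + 1)
    ≡ (2 * u + 2 * e + 1) * (2 * u + 2 * e + 1) + 4 * (suc (t + u) * suc (suc (t + u)))
  expand = solve-∀

lower-bound : ∀ {n t m e} j x → n ≤ T t → t < m → T m ≤ T e + n → j + (m + e) ≤ x →
  GeSqrt x t (2 * ((T t ∸ n) + t + 1)) (2 * j + 1)
lower-bound {n} {t} {m} {e} j x n≤Tt t<m Tm≤Te+n x≥ =
  GeSqrt-intro {x} {t} {2 * ((T t ∸ n) + t + 1)} {2 * j + 1} (2 * u + 2 * e + 1) width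
    (key-inequality t u e n≤Tt (subst (λ z → T z ≤ T e + n) (sym m≡) Tm≤Te+n))
  where
  u = m ∸ suc t
  m≡ : suc (t + u) ≡ m
  m≡ = m+[n∸m]≡n t<m
  twice : ∀ t u e j → 2 * t + (2 * j + 1) + (2 * u + 2 * e + 1) ≡ 2 * (j + (suc (t + u) + e))
  twice = solve-∀
  width : 2 * t + (2 * j + 1) + (2 * u + 2 * e + 1) ≤ 2 * x
  width = subst (_≤ 2 * x) (sym (trans (twice t u e j) (cong (λ z → 2 * (j + (z + e))) m≡)))
                (*-monoʳ-≤ 2 x≥)

T≤T+n : ∀ {m n V e} → V ≡ T m ∸ n → V ≤ T e → T m ≤ T e + n
T≤T+n {m} {n} {V} {e} refl V≤Te = begin
  T m               ≤⟨ m≤n+m∸n (T m) n ⟩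
  n + (T m ∸ n)     ≡⟨ +-comm n (T m ∸ n) ⟩
  (T m ∸ n) + n     ≤⟨ +-monoˡ-≤ n V≤Te ⟩
  T e + n           ∎
  where open ≤-Reasoning

volume-positive : ∀ n m → f n < m → 0 < T m ∸ n
volume-positive n m fn<m = m<n⇒0<n∸m (≤-<-trans (n≤T[fn] n) (T-strict fn<m))

lemma14 : (n m : ℕ) → 1 ≤ n → f n < m →
    ((A : Subset m) → vol A ≡ T m ∸ n →
        GeSqrt (m + per A) (f n) (2 * (g n + f n + 1)) 1)
    × ((A : Subset (m ∸ 1)) → vol A ≡ T m ∸ n →
        GeSqrt (m + perCompl A) (f n) (2 * (g n + f n + 1)) 3)
lemma14 n m _ fn<m = p-bound , q-bound
  where
  positive : ∀ {N} (A : Subset N) → vol A ≡ T m ∸ n → 0 < vol A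
  positive A volA = subst (0 <_) (sym volA) (volume-positive n m fn<m)

  p-bound : (A : Subset m) → vol A ≡ T m ∸ n →
    GeSqrt (m + per A) (f n) (2 * (g n + f n + 1)) 1
  p-bound A volA = lower-bound 0 (m + per A) (n≤T[fn] n) fn<m (T≤T+n {m} {n} {vol A} {e} volA vol≤T[e])
    (+-monoʳ-≤ m (bd≤per (inA A) e e<N (edge∈∂ (inA A) e e∈P suc-e∉P)))
    where open Top (top (inA A) m (N∉A A) (positive A volA))

  q-bound : (A : Subset (m ∸ 1)) → vol A ≡ T m ∸ n →
    GeSqrt (m + perCompl A) (f n) (2 * (g n + f n + 1)) 3
  q-bound A volA = lower-bound 1 (m + perCompl A) (n≤T[fn] n) fn<m (T≤T+n {m} {n} {vol A} {e} volA vol≤T[e])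
    (subst (_≤ m + perCompl A) (+-suc m e)
      (+-monoʳ-≤ m (bd≤per (λ y → not (inA A y)) (suc e) (s≤s e<N)
                             (edge∈∂ᶜ (inA A) e e∈P suc-e∉P))))
    where open Top (top (inA A) (m ∸ 1) (N∉A A) (positive A volA))
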